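{- Let $G$ be an edge-labelled graph and let $A,B,C$ be $\Delta$-implication classes of $G$ such that $C^{ -1}\neq A\neq B$. Suppose there are vertices $a,b,c$ with $(a,b)\in C$, $(b,c)\in A$ and $(a,c)\in B$. Then (1) for every $(u,v)\in A$ we have $(a,u)\in C$ and $(a,v)\in B$; and (2) no pair in $A$ is incident to $a$ (i.e. $a\notin\{u,v\}$ for all $(u,v)\in A$).
   Context: An edge-labelled graph is a finite graph $G=(V,E)$ with a loop at every vertex, in which every edge is labelled either "inclusion edge" or "overlap edge" (loops are labelled inclusion); labels need not reflect neighbourhoods. $u$ overlaps $v$ if $uv$ is an overlap edge. A vertex $z$ avoids the edge $xy$ (possibly $x=y$) if every neighbour of $z$ among $x,y$ overlaps $z$, and whenever $z$ overlaps both $x$ and $y$, $xy$ is an inclusion edge. Whenever an edge $xy$ avoids $z$ we write $(x,z)\,\Delta\,(y,z)$ and $(z,x)\,\Delta\,(z,y)$. An ordered pair $(a,b)$ is related to $(u,v)$ if there is a sequence $(a,b)=(p_0,q_0)\,\Delta\,(p_1,q_1)\,\Delta\cdots\Delta\,(p_m,q_m)=(u,v)$ with $m\ge 1$ (equivalently, an $au$-walk and a $bv$-walk that avoid each other); in particular $(a,b)$ is related to itself iff $ab$ is not an inclusion edge. A $\Delta$-implication class is a maximal set of ordered pairs that are pairwise related. For a class $A$, $A^{ -1}=\{(u,v):(v,u)\in A\}$, which is also a $\Delta$-implication class. -}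

module Defs where

open import Level using (0ℓ)
open import Data.Nat using (ℕ)
open import Data.Fin using (Fin)
open import Data.Bool using (Bool; true; false)
open import Data.Product using (_×_; _,_)
open import Relation.Binary.PropositionalEquality using (_≡_)
open import Relation.Unary using (Pred; _∈_; _⊆_; _≐_)
open import Relation.Binary.Construct.Closure.Transitive using (TransClosure)

-- An edge-labelled graph on the vertex set Fin n.
-- adj x y : xy is an edge (loops at every vertex, symmetric).
-- ov x y  : the edge xy is labelled "overlap" (otherwise "inclusion").
record ELGraph (n : ℕ) : Set where
  field
    adj     : Fin n → Fin n → Bool
    ov      : Fin n → Fin n → Bool
    adj-sym : ∀ x y → adj x y ≡ adj y x
    adj-loop : ∀ x → adj x x ≡ true
    ov-sym  : ∀ x y → ov x y ≡ ov y x
    ov-edge : ∀ x y → ov x y ≡ true → adj x y ≡ true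
    loop-incl : ∀ x → ov x x ≡ false

module _ {n : ℕ} (G : ELGraph n) where
  open ELGraph G

  Vertex : Set
  Vertex = Fin n

  Pair : Set
  Pair = Vertex × Vertex

  Edge : Vertex → Vertex → Set
  Edge x y = adj x y ≡ true

  Overlaps : Vertex → Vertex → Set
  Overlaps u v = (adj u v ≡ true) × (ov u v ≡ true)

  InclusionEdge : Vertex → Vertex → Set
  InclusionEdge x y = (adj x y ≡ true) × (ov x y ≡ false)

  Avoids : Vertex → Vertex → Vertex → Set
  Avoids z x y =
    (Edge z x → Overlaps z x) ×
    (Edge z y → Overlaps z y) ×
    (Overlaps z x → Overlaps z y → InclusionEdge x y)

  data Δ : Pair → Pair → Set where
    left  : ∀ {x y z} → Edge x y → Avoids z x y → Δ (x , z) (y , z)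
    right : ∀ {x y z} → Edge x y → Avoids z x y → Δ (z , x) (z , y)

  Related : Pair → Pair → Set
  Related = TransClosure Δ

  PairSet : Set₁
  PairSet = Pred Pair 0ℓ

  PairwiseRelated : PairSet → Set
  PairwiseRelated S = ∀ {p q} → p ∈ S → q ∈ S → Related p q

  record IsImplicationClass (A : PairSet) : Set₁ where
    field
      pairwise : PairwiseRelated A
      maximal  : (S : PairSet) → A ⊆ S → PairwiseRelated S → S ⊆ A

  inv : PairSet → PairSet
  inv A (u , v) = (v , u) ∈ A

  SameSet : PairSet → PairSet → Set
  SameSet A B = A ≐ B

-- Walk along a Δ-chain from (b,c) to any (u,v) ∈ A, keeping the invariant
-- (a,u) ∈ C and (a,v) ∈ B. A Δ-step moves one coordinate across an edge avoided
-- by the other coordinate; the triangle lemma says that a then either avoids the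
-- same edge, so the invariant survives, or the fixed coordinate avoids an edge to a,
-- which would put (a,v) or (u,a) into A and make A meet B or C⁻¹. Part (2) follows
-- because a pair (x,x) is never related to anything: loops are inclusion edges.
module Submission where

open import Defs
open import Data.Nat using (ℕ)
open import Data.Bool using (true; false)
open import Data.Sum using (_⊎_; inj₁; inj₂)
open import Data.Product using (_×_; _,_; proj₁; proj₂; swap)
open import Relation.Nullary using (¬_; Dec; yes; no; contradiction)
open import Function using (_∘_; const)
open import Relation.Unary using (_∈_; _∉_)
open import Relation.Binary.PropositionalEquality using (_≢_; _≡_; refl; sym; trans)
open import Relation.Binary.Construct.Closure.Transitive using ([_]; _∷_; _++_; symmetric)

module Properties {n : ℕ} (G : ELGraph n) where
  open ELGraph G

  NonInclusion : Vertex G → Vertex G → Set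
  NonInclusion x y = Edge G x y → Overlaps G x y

  Edge-sym : ∀ {x y} → Edge G x y → Edge G y x
  Edge-sym {x} {y} e = trans (adj-sym y x) e

  Overlaps-sym : ∀ {x y} → Overlaps G x y → Overlaps G y x
  Overlaps-sym {x} {y} (e , o) = Edge-sym e , trans (ov-sym y x) o

  InclusionEdge-sym : ∀ {x y} → InclusionEdge G x y → InclusionEdge G y x
  InclusionEdge-sym {x} {y} (e , o) = Edge-sym e , trans (ov-sym y x) o

  NonInclusion-sym : ∀ {x y} → NonInclusion x y → NonInclusion y x
  NonInclusion-sym f e = Overlaps-sym (f (Edge-sym e))

  Overlaps⇒¬InclusionEdge : ∀ {x y} → Overlaps G x y → ¬ InclusionEdge G x y
  Overlaps⇒¬InclusionEdge (_ , o) (_ , o') = contradiction (trans (sym o) o') λ ()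

  data Label (x y : Vertex G) : Set where
    no-edge        : ¬ Edge G x y → Label x y
    overlap-edge   : Overlaps G x y → Label x y
    inclusion-edge : InclusionEdge G x y → Label x y

  label : ∀ x y → Label x y
  label x y with adj x y in e | ov x y in o
  ... | false | _     = no-edge λ e' → contradiction (trans (sym e) e') λ ()
  ... | true  | true  = overlap-edge (e , o)
  ... | true  | false = inclusion-edge (e , o)

  Overlaps? : ∀ x y → Dec (Overlaps G x y)
  Overlaps? x y with label x y
  ... | no-edge ¬e       = no (¬e ∘ proj₁)
  ... | overlap-edge o   = yes o
  ... | inclusion-edge i = no λ o → Overlaps⇒¬InclusionEdge o i

  Avoids-sym : ∀ {z x y} → Avoids G z x y → Avoids G z y x
  Avoids-sym (fx , fy , h) = fy , fx , λ oy ox → InclusionEdge-sym (h ox oy)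

  avoids-redirect : ∀ {w c c' a} → Avoids G w c c' → NonInclusion w a →
                    (Overlaps G w c → Overlaps G w a → InclusionEdge G c a) → Avoids G w c a
  avoids-redirect (fc , _ , _) nwa h = fc , nwa , h

  -- In Δ terms: a step (c,w) Δ (c',w) yields (a,c) Δ (a,c'), (c,w) Δ (a,w) or (c',w) Δ (a,w).
  triangle : ∀ {a w c c'} → NonInclusion a c → NonInclusion w a → Edge G c c' → Avoids G w c c' →
             Avoids G a c c' ⊎ (Edge G c a × Avoids G w c a) ⊎ (Edge G c' a × Avoids G w c' a)
  triangle {a} {w} {c} {c'} nac nwa ecc' av with label a c'
  ... | no-edge ¬eac' =
        inj₁ (nac , (λ e → contradiction e ¬eac') , λ _ o → contradiction (proj₁ o) ¬eac')
  ... | inclusion-edge iac' =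
        inj₂ (inj₂ (Edge-sym (proj₁ iac') , avoids-redirect (Avoids-sym av) nwa λ _ _ → InclusionEdge-sym iac'))
  ... | overlap-edge oac' with label a c
  ...   | no-edge ¬eac = inj₁ (nac , const oac' , λ o _ → contradiction (proj₁ o) ¬eac)
  ...   | inclusion-edge iac = contradiction iac (Overlaps⇒¬InclusionEdge (nac (proj₁ iac)))
  ...   | overlap-edge oac with label c c'
  ...     | no-edge ¬ecc' = contradiction ecc' ¬ecc'
  ...     | inclusion-edge icc' = inj₁ (nac , const oac' , λ _ _ → icc')
  ...     | overlap-edge occ' with Overlaps? w c
  ...       | no ¬owc =
              inj₂ (inj₁ (Edge-sym (proj₁ oac) , avoids-redirect av nwa λ owc _ → contradiction owc ¬owc))
  ...       | yes owc =
              inj₂ (inj₂ (Edge-sym (proj₁ oac') , avoids-redirect (Avoids-sym av) nwa λ owc' _ →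
                contradiction (proj₂ (proj₂ av) owc owc') (Overlaps⇒¬InclusionEdge occ')))

  Δ-sym : ∀ {p q} → Δ G p q → Δ G q p
  Δ-sym (left e av)  = left (Edge-sym e) (Avoids-sym av)
  Δ-sym (right e av) = right (Edge-sym e) (Avoids-sym av)

  Δ-swap : ∀ {p q} → Δ G p q → Δ G (swap p) (swap q)
  Δ-swap (left e av)  = right e av
  Δ-swap (right e av) = left e av

  Related-sym : ∀ {p q} → Related G p q → Related G q p
  Related-sym = symmetric (Δ G) Δ-sym

  Related-swap : ∀ {p q} → Related G p q → Related G (swap p) (swap q)
  Related-swap [ d ]   = [ Δ-swap d ]
  Related-swap (d ∷ r) = Δ-swap d ∷ Related-swap r

  Δ⇒NonInclusion : ∀ {x y q} → Δ G (x , y) q → NonInclusion x y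
  Δ⇒NonInclusion (left _ (f , _))  = NonInclusion-sym f
  Δ⇒NonInclusion (right _ (f , _)) = f

  Related⇒NonInclusion : ∀ {x y q} → Related G (x , y) q → NonInclusion x y
  Related⇒NonInclusion [ d ]   = Δ⇒NonInclusion d
  Related⇒NonInclusion (d ∷ _) = Δ⇒NonInclusion d

  module _ {A : PairSet G} (IA : IsImplicationClass G A) where
    open IsImplicationClass IA

    class-closed : ∀ {p q} → p ∈ A → Related G p q → q ∈ A
    class-closed {p} {q} pA p~q = maximal (λ r → r ∈ A ⊎ r ≡ q) inj₁ related (inj₂ refl)
      where
        related : PairwiseRelated G (λ r → r ∈ A ⊎ r ≡ q)
        related (inj₁ rA)   (inj₁ sA)   = pairwise rA sA
        related (inj₁ rA)   (inj₂ refl) = pairwise rA pA ++ p~q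
        related (inj₂ refl) (inj₁ sA)   = Related-sym p~q ++ pairwise pA sA
        related (inj₂ refl) (inj₂ refl) = Related-sym p~q ++ p~q

    class-NonInclusion : ∀ {x y} → (x , y) ∈ A → NonInclusion x y
    class-NonInclusion xyA = Related⇒NonInclusion (pairwise xyA xyA)

    class-irreflexive : ∀ {x} → (x , x) ∉ A
    class-irreflexive {x} xxA =
      Overlaps⇒¬InclusionEdge (class-NonInclusion xxA (adj-loop x)) (adj-loop x , loop-incl x)

  classes-meet⇒≐ : ∀ {A B p} → IsImplicationClass G A → IsImplicationClass G B →
                   p ∈ A → p ∈ B → SameSet G A B
  classes-meet⇒≐ IA IB pA pB =
    (λ qA → class-closed IB pB (pairwise IA pA qA)) , (λ qB → class-closed IA pA (pairwise IB pB qB))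
    where open IsImplicationClass

  classes-meet-inv⇒≐ : ∀ {A C x y} → IsImplicationClass G A → IsImplicationClass G C →
                       (y , x) ∈ C → (x , y) ∈ A → SameSet G (inv G C) A
  classes-meet-inv⇒≐ IA IC yxC xyA =
    (λ qC → class-closed IA xyA (Related-swap (pairwise IC yxC qC))) ,
    (λ qA → class-closed IC yxC (Related-swap (pairwise IA xyA qA)))
    where open IsImplicationClass

module AnchoredWalk {n : ℕ} (G : ELGraph n) {A B C : PairSet G}
  (IA : IsImplicationClass G A) (IB : IsImplicationClass G B) (IC : IsImplicationClass G C)
  (C⁻¹≉A : ¬ SameSet G (inv G C) A) (A≉B : ¬ SameSet G A B) (a : Vertex G) where
  open Properties G

  Anchored : Pair G → Set
  Anchored (x , y) = (x , y) ∈ A × (a , x) ∈ C × (a , y) ∈ B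

  A∩B-empty : ∀ {p} → p ∈ A → p ∉ B
  A∩B-empty pA pB = A≉B (classes-meet⇒≐ IA IB pA pB)

  A∩C⁻¹-empty : ∀ {x y} → (x , y) ∈ A → (y , x) ∉ C
  A∩C⁻¹-empty xyA yxC = C⁻¹≉A (classes-meet-inv⇒≐ IA IC yxC xyA)

  anchored-step : ∀ {p q} → Anchored p → Δ G p q → Anchored q
  anchored-step (xyA , axC , ayB) (left e av)
    with triangle (class-NonInclusion IC axC) (NonInclusion-sym (class-NonInclusion IB ayB)) e av
  ... | inj₁ av' = class-closed IA xyA [ left e av ] , class-closed IC axC [ right e av' ] , ayB
  ... | inj₂ (inj₁ (e' , av')) = contradiction ayB (A∩B-empty (class-closed IA xyA [ left e' av' ]))
  ... | inj₂ (inj₂ (e' , av')) =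
        contradiction ayB (A∩B-empty (class-closed IA xyA (left e av ∷ [ left e' av' ])))
  anchored-step (xyA , axC , ayB) (right e av)
    with triangle (class-NonInclusion IB ayB) (NonInclusion-sym (class-NonInclusion IC axC)) e av
  ... | inj₁ av' = class-closed IA xyA [ right e av ] , axC , class-closed IB ayB [ right e av' ]
  ... | inj₂ (inj₁ (e' , av')) = contradiction axC (A∩C⁻¹-empty (class-closed IA xyA [ right e' av' ]))
  ... | inj₂ (inj₂ (e' , av')) =
        contradiction axC (A∩C⁻¹-empty (class-closed IA xyA (right e av ∷ [ right e' av' ])))

  anchored-walk : ∀ {p q} → Anchored p → Related G p q → Anchored q
  anchored-walk anc [ d ]   = anchored-step anc d
  anchored-walk anc (d ∷ r) = anchored-walk (anchored-step anc d) r

lemma17 : {n : ℕ} (G : ELGraph n) (A B C : PairSet G) →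
    IsImplicationClass G A → IsImplicationClass G B → IsImplicationClass G C →
    ¬ SameSet G (inv G C) A → ¬ SameSet G A B →
    (a b c : Vertex G) → (a , b) ∈ C → (b , c) ∈ A → (a , c) ∈ B →
    (∀ u v → (u , v) ∈ A → ((a , u) ∈ C) × ((a , v) ∈ B)) ×
    (∀ u v → (u , v) ∈ A → (a ≢ u) × (a ≢ v))
lemma17 G A B C IA IB IC C⁻¹≉A A≉B a b c abC bcA acB = anchors , off-a
  where
  open Properties G
  open AnchoredWalk G IA IB IC C⁻¹≉A A≉B a

  anchors : ∀ u v → (u , v) ∈ A → ((a , u) ∈ C) × ((a , v) ∈ B)
  anchors u v uvA = proj₂ (anchored-walk (bcA , abC , acB) (IsImplicationClass.pairwise IA bcA uvA))

  off-a : ∀ u v → (u , v) ∈ A → (a ≢ u) × (a ≢ v)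
  off-a u v uvA = (λ { refl → class-irreflexive IC (proj₁ (anchors u v uvA)) })
                , (λ { refl → class-irreflexive IB (proj₂ (anchors u v uvA)) })
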